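{- Let $G$ be an infinite abelian group and suppose there is a subgroup $H$ of $G$ with $G/H\cong\mathbb{Z}$. Then for every integer $h\geq 1$, $X_G(h)\geq\left[\frac{h(h+4)}{3}\right]$.
   Context: $[x]$ denotes the integer part. For $A\subset G$ and a positive integer $h$, $hA$ is the set of sums of $h$ not necessarily distinct elements of $A$; $A\sim B$ means finite symmetric difference. $\operatorname{ord}^*_G(A)$ is the least $k$ with $kA\sim G$ ($\infty$ if none). $A$ is a basis if $\operatorname{ord}^*_G(A)<\infty$. For a basis $A$, $a\in A$ is regular if $A\setminus\{a\}$ is still a basis; $A^*$ is the set of regular elements. $X_G(h)=\sup\{\operatorname{ord}^*_G(A\setminus\{a\}) : A\subset G,\ hA\sim G,\ a\in A^*\}$. -}

module Defs where

open import Level using (0ℓ)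
open import Algebra.Bundles using (AbelianGroup)
open import Data.Nat using (ℕ; zero; suc; _<_; _≤_)
open import Data.Integer as ℤ using (ℤ)
open import Data.Vec using (Vec; []; _∷_)
open import Data.Vec.Relation.Unary.All using (All)
open import Data.List using (List)
open import Data.List.Relation.Unary.Any using (Any)
open import Data.Product using (Σ; ∃; _×_; _,_)
open import Relation.Nullary using (¬_)
open import Function.Bundles using (_⇔_)
open import Data.Unit using (⊤)
open import Relation.Binary.PropositionalEquality using (_≡_)

module _ (G : AbelianGroup 0ℓ 0ℓ) where
  open AbelianGroup G

  Subset : Set₁
  Subset = Carrier → Set

  vsum : ∀ {n} → Vec Carrier n → Carrier
  vsum [] = ε
  vsum (x ∷ xs) = x ∙ vsum xs

  -- hA : sums of h (not necessarily distinct) elements of A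
  sumset : ℕ → Subset → Subset
  sumset h A x = Σ (Vec Carrier h) λ v → All A v × (vsum v ≈ x)

  univ : Subset
  univ _ = ⊤

  remove : Subset → Carrier → Subset
  remove A a x = A x × ¬ (x ≈ a)

  -- A ~ B : symmetric difference is finite, i.e. contained in a finite list
  _∼_ : Subset → Subset → Set
  A ∼ B = Σ (List Carrier) λ L → ∀ x → ¬ Any (x ≈_) L → (A x ⇔ B x)

  IsBasis : Subset → Set
  IsBasis A = Σ ℕ λ k → (1 ≤ k) × (sumset k A ∼ univ)

  Regular : Subset → Carrier → Set
  Regular A a = A a × IsBasis (remove A a)

  -- ord*_G(A) ≥ N  (in ℕ ∪ {∞}): no k with 1 ≤ k < N has kA ~ G
  OrdAtLeast : Subset → ℕ → Set
  OrdAtLeast A N = ∀ k → 1 ≤ k → k < N → ¬ (sumset k A ∼ univ)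

  -- X_G(h) ≥ N : the supremum (over a set of values in ℕ ∪ {∞}) is ≥ the
  -- finite N iff some member of the set is ≥ N
  XAtLeast : ℕ → ℕ → Set₁
  XAtLeast h N = Σ Subset λ A → Σ Carrier λ a →
    (sumset h A ∼ univ) × Regular A a × OrdAtLeast (remove A a) N

  Infinite : Set
  Infinite = ¬ (Σ (List Carrier) λ L → ∀ x → Any (x ≈_) L)

  -- surjective group homomorphism G → ℤ (G/ker φ ≅ ℤ)
  record SurjHomToℤ : Set where
    field
      φ : Carrier → ℤ
      φ-cong : ∀ {x y} → x ≈ y → φ x ≡ φ y
      φ-hom : ∀ x y → φ (x ∙ y) ≡ φ x ℤ.+ φ y
      φ-surj : ∀ z → Σ Carrier λ x → φ x ≡ z

module Submission where

-- Fix a modulus m and let Low = {x : φ x ≡ 0 or 1 (mod m)}.  Low is a basis of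
-- G (m summands suffice), but a sum of k elements of Low has residue in
-- {0,…,k}, so for k < m - 1 the infinitely many x with φ x ≡ -1 are missing
-- from k·Low: ord*(Low) ≥ m - 1.  Adding one element a with φ a = s makes
-- A = Low ∪ {a} a basis of order h as soon as every residue mod m can be
-- written i·s + j with i < h and i + j ≤ h (a covering of ℤ/mℤ, "Reach").
-- Then a is a regular element of A and witnesses X_G(h) ≥ N for all N < m.

open import Defs
open import Level using (0ℓ)
open import Algebra.Bundles using (AbelianGroup)
open import Data.Nat using (ℕ; _≤_; _*_; _+_; _/_)
open import Data.Nat.Base as ℕ
  using (zero; suc; _∸_; _<_; z≤n; s≤s; s≤s⁻¹; NonZero; _%_; compare; less; equal; greater)
open import Data.Nat.Properties
  using (≤-refl; ≤-trans; <⇒≤; <⇒≱; ≰⇒>; ≤-<-trans; <-≤-trans; _≤?_; m≤n⇒∃[o]m+o≡n; n≤1+n; m≤m+n; m≤n+m; m≤m*n;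
         +-comm; +-identityʳ; +-suc; +-mono-≤; +-monoʳ-≤; +-cancelˡ-≤; +-cancelʳ-<; m+[n∸m]≡n; m∸n≤m; m<n⇒0<n∸m)
open import Data.Nat.DivMod using (m≡m%n+[m/n]*n; m%n<n; m<n*o⇒m/o<n)
open import Data.Nat.Divisibility using (divides; ∣⇒≤)
open import Data.Nat.Tactic.RingSolver using (solve)
open import Data.List.Base using (List; []; _∷_)
open import Data.Product.Base using (Σ; _×_; _,_; proj₁; proj₂)
open import Data.Sum.Base using (_⊎_; inj₁; inj₂)
open import Data.Empty using (⊥; ⊥-elim)
open import Data.Unit using (tt)
open import Relation.Nullary using (¬_; yes; no)
open import Function.Bundles using (mk⇔; Equivalence)
open import Relation.Binary.PropositionalEquality using (_≡_; _≢_; refl; sym; trans; cong; cong₂; subst; subst₂)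

record Representation (m h s r : ℕ) : Set where
  constructor representation
  field
    copies ones wraps : ℕ
    copies<h : copies < h
    total≤h : copies + ones ≤ h
    value : copies * s + ones ≡ r + wraps * m

Reach : ℕ → ℕ → ℕ → Set
Reach m h s = ∀ r → r < m → Representation m h s r

step height modulus : ℕ → ℕ → ℕ
step p c = 5 + p + 2 * c
height p c = 1 + 2 * p + c
modulus p c = 2 + c + p * step p c

-- a ≤ b witnessed by an explicit slack; the slack equations are ring identities.
≤-by-slack : ∀ {a b} k → a + k ≡ b → a ≤ b
≤-by-slack {a} k refl = m≤m+n a k

-- Writing r = u + t·s with u < s, the quotient t never exceeds p.
beyond-modulus : ∀ p c k u → ¬ (u + suc (p + k) * step p c < modulus p c)
beyond-modulus p c k u r<m = <⇒≱ r<m (≤-by-slack (u + k * step p c + p + c + 3) overshoot)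
  where
  overshoot : 2 + c + p * (5 + p + 2 * c) + (u + k * (5 + p + 2 * c) + p + c + 3)
            ≡ u + suc (p + k) * (5 + p + 2 * c)
  overshoot = solve (p ∷ c ∷ k ∷ u ∷ [])

-- t = p: then u ≤ c + 1 and (i, j) = (p, u) works.
represent-top : ∀ p c u → u + p * step p c < modulus p c →
  Representation (modulus p c) (height p c) (step p c) (u + p * step p c)
represent-top p c u r<m = representation p u 0 p<h p+u≤h value
  where
  u≤c+1 : u ≤ 1 + c
  u≤c+1 = s≤s⁻¹ (+-cancelʳ-< (p * step p c) u (2 + c) r<m)
  p<h : p < 1 + 2 * p + c
  p<h = ≤-by-slack (p + c) (solve (p ∷ c ∷ []))
  p+u≤h : p + u ≤ 1 + 2 * p + c
  p+u≤h = ≤-trans (+-monoʳ-≤ p u≤c+1) (≤-by-slack {p + (1 + c)} p (solve (p ∷ c ∷ [])))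
  value : p * step p c + u ≡ u + p * step p c + 0 * modulus p c
  value = trans (+-comm (p * step p c) u) (sym (+-identityʳ _))

-- t < p, say p = t + w + 1, and u small: (i, j) = (t, u) works.
represent-low : ∀ t w c u → u ≤ t + 2 * w + c + 3 →
  let p = suc (t + w) in
  Representation (modulus p c) (height p c) (step p c) (u + t * step p c)
represent-low t w c u u≤ = representation t u 0 t<h t+u≤h value
  where
  t<h : t < 1 + 2 * suc (t + w) + c
  t<h = ≤-by-slack (t + 2 * w + c + 2) (solve (t ∷ w ∷ c ∷ []))
  t+u≤h : t + u ≤ 1 + 2 * suc (t + w) + c
  t+u≤h = ≤-trans (+-monoʳ-≤ t u≤) (≤-by-slack {t + (t + 2 * w + c + 3)} 0 (solve (t ∷ w ∷ c ∷ [])))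
  value : t * step (suc (t + w)) c + u ≡ u + t * step (suc (t + w)) c + 0 * modulus (suc (t + w)) c
  value = trans (+-comm (t * step (suc (t + w)) c) u) (sym (+-identityʳ _))

-- t < p, p = t + w + 1, and u = t + 2w + c + 4 + k large: wrap around once,
-- (i, j) = (p + t + 1, w + k) represents r + m, and u < s forces k ≤ c + 1.
represent-wrap : ∀ t w c k → let p = suc (t + w) ; u = suc (t + 2 * w + c + 3) + k in
  u < step p c →
  Representation (modulus p c) (height p c) (step p c) (u + t * step p c)
represent-wrap t w c k u<s = representation (2 + 2 * t + w) (w + k) 1 i<h i+j≤h value
  where
  w+k≤c+1 : w + k ≤ c + 1
  w+k≤c+1 = +-cancelˡ-≤ (t + w + c + 5) (w + k) (c + 1) (subst₂ _≤_ u+1≡ s≡ u<s)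
    where
    u+1≡ : suc (suc (t + 2 * w + c + 3) + k) ≡ t + w + c + 5 + (w + k)
    u+1≡ = solve (t ∷ w ∷ c ∷ k ∷ [])
    s≡ : 5 + suc (t + w) + 2 * c ≡ t + w + c + 5 + (c + 1)
    s≡ = solve (t ∷ w ∷ c ∷ [])
  i<h : 2 + 2 * t + w < 1 + 2 * suc (t + w) + c
  i<h = ≤-by-slack (w + c) (solve (t ∷ w ∷ c ∷ []))
  i+j≤h : 2 + 2 * t + w + (w + k) ≤ 1 + 2 * suc (t + w) + c
  i+j≤h = subst₂ _≤_ i+j≡ h≡ (+-monoʳ-≤ (2 + 2 * t + 2 * w) (≤-trans (m≤n+m k w) w+k≤c+1))
    where
    i+j≡ : 2 + 2 * t + 2 * w + k ≡ 2 + 2 * t + w + (w + k)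
    i+j≡ = solve (t ∷ w ∷ k ∷ [])
    h≡ : 2 + 2 * t + 2 * w + (c + 1) ≡ 1 + 2 * suc (t + w) + c
    h≡ = solve (t ∷ w ∷ c ∷ [])
  value : (2 + 2 * t + w) * (5 + suc (t + w) + 2 * c) + (w + k)
        ≡ suc (t + 2 * w + c + 3) + k + t * (5 + suc (t + w) + 2 * c)
          + 1 * (2 + c + suc (t + w) * (5 + suc (t + w) + 2 * c))
  value = solve (t ∷ w ∷ c ∷ k ∷ [])

represent : ∀ p c t u → u < step p c → u + t * step p c < modulus p c →
  Representation (modulus p c) (height p c) (step p c) (u + t * step p c)
represent p c t u u<s r<m with compare t p
... | equal t = represent-top t c u r<m
... | greater p k = ⊥-elim (beyond-modulus p c k u r<m)
... | less t w with u ≤? t + 2 * w + c + 3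
...   | yes u≤ = represent-low t w c u u≤
...   | no u≰ with m≤n⇒∃[o]m+o≡n (≰⇒> u≰)
...     | k , refl = represent-wrap t w c k u<s

reach-family : ∀ p c → Reach (modulus p c) (height p c) (step p c)
reach-family p c r r<m =
  subst (Representation (modulus p c) (height p c) (step p c)) (sym r≡)
    (represent p c (r / step p c) (r % step p c) (m%n<n r (step p c)) (subst (_< modulus p c) r≡ r<m))
  where
  r≡ : r ≡ r % step p c + r / step p c * step p c
  r≡ = m≡m%n+[m/n]*n r (step p c)

-- The case h = 2, outside the family: modulus 5 and step 3.
reach-5-2-3 : Reach 5 2 3
reach-5-2-3 0 _ = representation 0 0 0 (s≤s z≤n) z≤n refl
reach-5-2-3 1 _ = representation 0 1 0 (s≤s z≤n) (s≤s z≤n) refl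
reach-5-2-3 2 _ = representation 0 2 0 (s≤s z≤n) (s≤s (s≤s z≤n)) refl
reach-5-2-3 3 _ = representation 1 0 0 (s≤s (s≤s z≤n)) (s≤s z≤n) refl
reach-5-2-3 4 _ = representation 1 1 0 (s≤s (s≤s z≤n)) (s≤s (s≤s z≤n)) refl
reach-5-2-3 (suc (suc (suc (suc (suc _))))) (s≤s (s≤s (s≤s (s≤s (s≤s ())))))

step<modulus : ∀ p c → 1 ≤ p → step p c < modulus p c
step<modulus (suc p) c _ = ≤-by-slack (1 + c + p * (5 + suc p + 2 * c)) slack
  where
  slack : suc (5 + suc p + 2 * c) + (1 + c + p * (5 + suc p + 2 * c))
        ≡ 2 + c + suc p * (5 + suc p + 2 * c)
  slack = solve (p ∷ c ∷ [])

record Parameters (h : ℕ) : Set where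
  constructor parameters
  field
    p c : ℕ
    1≤p : 1 ≤ p
    height≡h : height p c ≡ h
    bound : h * (h + 4) < modulus p c * 3

-- Since 3m − h(h+4) = 3 − (d−1)(d−2) for d = p − c, the choices d = 1, 0, 2,
-- i.e. (p, c) = (k+1, k), (k+1, k+1), (k+2, k), realise h = 3 + 3k + ρ for ρ = 0, 1, 2.
parameters-mod3 : ∀ k ρ → ρ < 3 → Parameters (3 + (ρ + k * 3))
parameters-mod3 k 0 _ = parameters (1 + k) k (s≤s z≤n) h≡ (≤-by-slack 2 bound)
  where
  h≡ : 1 + 2 * (1 + k) + k ≡ 3 + (0 + k * 3)
  h≡ = solve (k ∷ [])
  bound : suc ((3 + (0 + k * 3)) * (3 + (0 + k * 3) + 4)) + 2
        ≡ (2 + k + (1 + k) * (5 + (1 + k) + 2 * k)) * 3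
  bound = solve (k ∷ [])
parameters-mod3 k 1 _ = parameters (1 + k) (1 + k) (s≤s z≤n) h≡ (≤-by-slack 0 bound)
  where
  h≡ : 1 + 2 * (1 + k) + (1 + k) ≡ 3 + (1 + k * 3)
  h≡ = solve (k ∷ [])
  bound : suc ((3 + (1 + k * 3)) * (3 + (1 + k * 3) + 4)) + 0
        ≡ (2 + (1 + k) + (1 + k) * (5 + (1 + k) + 2 * (1 + k))) * 3
  bound = solve (k ∷ [])
parameters-mod3 k 2 _ = parameters (2 + k) k (s≤s z≤n) h≡ (≤-by-slack 2 bound)
  where
  h≡ : 1 + 2 * (2 + k) + k ≡ 3 + (2 + k * 3)
  h≡ = solve (k ∷ [])
  bound : suc ((3 + (2 + k * 3)) * (3 + (2 + k * 3) + 4)) + 2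
        ≡ (2 + k + (2 + k) * (5 + (2 + k) + 2 * k)) * 3
  bound = solve (k ∷ [])
parameters-mod3 k (suc (suc (suc _))) (s≤s (s≤s (s≤s ())))

parameters-for : ∀ n → Parameters (3 + n)
parameters-for n = subst (λ r → Parameters (3 + r)) (sym (m≡m%n+[m/n]*n n 3))
  (parameters-mod3 (n / 3) (n % 3) (m%n<n n 3))

-- j ones are j' ones plus a remainder e ≤ 1, with i + j' < h; the last one
-- (if any) is absorbed into an element of residue 1.
split-ones : ∀ {i j h} → i < h → i + j ≤ h →
  Σ ℕ λ j' → Σ ℕ λ e → e ≤ 1 × j ≡ j' + e × i + j' < h
split-ones {i} {zero} {h} i<h _ = 0 , 0 , z≤n , refl , subst (_< h) (sym (+-identityʳ i)) i<h
split-ones {i} {suc j} {h} _ i+j<h = j , 1 , s≤s z≤n , +-comm 1 j , subst (_≤ h) (+-suc i j) i+j<h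

module SumsetAlgebra (G : AbelianGroup 0ℓ 0ℓ) where
  open import Data.Vec.Base using (Vec; []; _∷_; _++_; replicate)
  open import Data.Vec.Relation.Unary.All using (All; []; _∷_)
  open import Data.Vec.Relation.Unary.All.Properties using (++⁺)
  open import Data.List.Relation.Unary.Any using (Any; here)
  open AbelianGroup G renaming (refl to ≈-refl; sym to ≈-sym; trans to ≈-trans)
  open import Relation.Binary.Reasoning.Setoid setoid

  multiple : ℕ → Carrier → Carrier
  multiple n b = vsum G (replicate n b)

  multiple-ε : ∀ n → multiple n ε ≈ ε
  multiple-ε zero = ≈-refl
  multiple-ε (suc n) = ≈-trans (∙-congˡ (multiple-ε n)) (identityˡ ε)

  vsum-++ : ∀ {k l} (v : Vec Carrier k) (w : Vec Carrier l) → vsum G (v ++ w) ≈ vsum G v ∙ vsum G w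
  vsum-++ [] w = ≈-sym (identityˡ _)
  vsum-++ (x ∷ v) w = begin
    x ∙ vsum G (v ++ w)       ≈⟨ ∙-congˡ (vsum-++ v w) ⟩
    x ∙ (vsum G v ∙ vsum G w) ≈⟨ assoc _ _ _ ⟨
    (x ∙ vsum G v) ∙ vsum G w ∎

  module Sumsets (S : Subset G) where

    sumset-∙ : ∀ {k l x y} → sumset G k S x → sumset G l S y → sumset G (k + l) S (x ∙ y)
    sumset-∙ (v , v∈S , v≈x) (w , w∈S , w≈y) = v ++ w , ++⁺ v∈S w∈S , ≈-trans (vsum-++ v w) (∙-cong v≈x w≈y)

    sumset-≈ : ∀ {k x y} → sumset G k S x → x ≈ y → sumset G k S y
    sumset-≈ (v , v∈S , v≈x) x≈y = v , v∈S , ≈-trans v≈x x≈y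

    sumset-single : ∀ {y} → S y → sumset G 1 S y
    sumset-single {y} y∈S = y ∷ [] , y∈S ∷ [] , identityʳ y

    sumset-multiple : ∀ n {b} → S b → sumset G n S (multiple n b)
    sumset-multiple n {b} b∈S = replicate n b , all-replicate n , ≈-refl
      where
      all-replicate : ∀ n → All S (replicate n b)
      all-replicate zero = []
      all-replicate (suc n) = b∈S ∷ all-replicate n

    -- if 0 ∈ S then kS ⊆ hS for k ≤ h: pad with zeros
    sumset-mono : S ε → ∀ {k h x} → k ≤ h → sumset G k S x → sumset G h S x
    sumset-mono ε∈S {k} {h} {x} k≤h x∈kS = subst (λ n → sumset G n S x) (m+[n∸m]≡n k≤h)
      (sumset-≈ (sumset-∙ x∈kS (sumset-multiple (h ∸ k) ε∈S)) x+0≈x)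
      where
      x+0≈x : x ∙ multiple (h ∸ k) ε ≈ x
      x+0≈x = ≈-trans (∙-congˡ (multiple-ε (h ∸ k))) (identityʳ x)

  cofinite : ∀ {P : Subset G} L → (∀ x → ¬ Any (x ≈_) L → P x) → _∼_ G P (univ G)
  cofinite L P⊇G∖L = L , λ x x∉L → mk⇔ (λ _ → tt) (λ _ → P⊇G∖L x x∉L)

  -- h = 1: A = G with a = ε, a basis of order 1; the bound [5/3] = 1 is vacuous
  X-at-one : XAtLeast G 1 1
  X-at-one = univ G , ε , cofinite [] (λ x _ → Sumsets.sumset-single (univ G) tt) ,
    (tt , 1 , s≤s z≤n ,
      cofinite (ε ∷ []) (λ x x∉[ε] → Sumsets.sumset-single (remove G (univ G) ε) (tt , λ x≈ε → x∉[ε] (here x≈ε)))) ,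
    λ { (suc _) _ (s≤s ()) }

module Construction (G : AbelianGroup 0ℓ 0ℓ) (hom : SurjHomToℤ G) where
  open import Data.Vec.Base using (Vec; []; _∷_)
  open import Data.Vec.Relation.Unary.All as All using (All; []; _∷_)
  open import Data.List.Relation.Unary.Any using (Any; here; there)
  open import Data.Integer.Base as ℤ using (ℤ; +_; 0ℤ; 1ℤ; -1ℤ; ∣_∣)
  import Data.Integer.Properties as ℤP
  open import Data.Integer.DivMod using (_%ℕ_; _/ℕ_; a≡a%ℕn+[a/ℕn]*n; n%ℕd<d)
  open import Data.Integer.Tactic.RingSolver using (solve-∀)
  open import Algebra.Properties.Group (AbelianGroup.group ℤP.+-0-abelianGroup)
    using () renaming (identityʳ-unique to ℤ-identityʳ-unique; inverseʳ-unique to ℤ-inverseʳ-unique; ∙-cancelˡ to ℤ-cancelˡ)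
  open AbelianGroup G renaming (refl to ≈-refl; sym to ≈-sym; trans to ≈-trans)
  open import Algebra.Properties.AbelianGroup G using (xyx⁻¹≈y)
  open SurjHomToℤ hom
  open SumsetAlgebra G

  φ-ε : φ ε ≡ 0ℤ
  φ-ε = ℤ-identityʳ-unique (φ ε) (φ ε) (trans (sym (φ-hom ε ε)) (φ-cong (identityʳ ε)))

  φ-⁻¹ : ∀ y → φ (y ⁻¹) ≡ ℤ.- φ y
  φ-⁻¹ y = ℤ-inverseʳ-unique (φ y) (φ (y ⁻¹)) (trans (sym (φ-hom y (y ⁻¹))) (trans (φ-cong (inverseʳ y)) φ-ε))

  φ-quotient : ∀ x y → φ (x ∙ y ⁻¹) ≡ φ x ℤ.- φ y
  φ-quotient x y = trans (φ-hom x (y ⁻¹)) (cong (λ t → φ x ℤ.+ t) (φ-⁻¹ y))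

  φ-multiple : ∀ n b → φ (multiple n b) ≡ + n ℤ.* φ b
  φ-multiple zero b = trans φ-ε (sym (ℤP.*-zeroˡ (φ b)))
  φ-multiple (suc n) b = trans (φ-hom b (multiple n b))
    (trans (cong (λ t → φ b ℤ.+ t) (φ-multiple n b)) (sym (ℤP.suc-* (+ n) (φ b))))

  module Modulo (m : ℕ) .{{_ : NonZero m}} where

    record Residue (z r : ℤ) : Set where
      constructor residue
      field
        quotient : ℤ
        equation : z ≡ r ℤ.+ quotient ℤ.* + m

    residue-refl : ∀ z → Residue z z
    residue-refl z = residue 0ℤ (sym (ℤP.+-identityʳ z))

    residue-+ : ∀ {z z' r r'} → Residue z r → Residue z' r' → Residue (z ℤ.+ z') (r ℤ.+ r')
    residue-+ {r = r} {r'} (residue q refl) (residue q' refl) = residue (q ℤ.+ q') (regroup r r' q q' (+ m))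
      where
      regroup : ∀ r r' q q' M → (r ℤ.+ q ℤ.* M) ℤ.+ (r' ℤ.+ q' ℤ.* M) ≡ (r ℤ.+ r') ℤ.+ (q ℤ.+ q') ℤ.* M
      regroup = solve-∀

    residue-shift : ∀ {z r w} → Residue z (r ℤ.+ w) → Residue (z ℤ.- w) r
    residue-shift {r = r} {w} (residue q refl) = residue q (cancel r w q (+ m))
      where
      cancel : ∀ r w q M → (r ℤ.+ w ℤ.+ q ℤ.* M) ℤ.- w ≡ r ℤ.+ q ℤ.* M
      cancel = solve-∀

    residue-sym : ∀ {z r} → Residue z r → Residue r z
    residue-sym {z} {r} (residue q z≡r) = residue (ℤ.- q) (trans (unshift r q (+ m)) (cong (λ t → t ℤ.+ ℤ.- q ℤ.* + m) (sym z≡r)))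
      where
      unshift : ∀ r q M → r ≡ (r ℤ.+ q ℤ.* M) ℤ.+ ℤ.- q ℤ.* M
      unshift = solve-∀

    residue-trans : ∀ {z r r'} → Residue z r → Residue r r' → Residue z r'
    residue-trans {r' = r'} (residue q refl) (residue q' refl) = residue (q' ℤ.+ q) (regroup r' q' q (+ m))
      where
      regroup : ∀ r' q' q M → r' ℤ.+ q' ℤ.* M ℤ.+ q ℤ.* M ≡ r' ℤ.+ (q' ℤ.+ q) ℤ.* M
      regroup = solve-∀

    not-multiple : ∀ {t} q → 0 < t → t < m → + t ≢ q ℤ.* + m
    not-multiple {t} q 0<t t<m t≡qm = <⇒≱ t<m (∣⇒≤ {{ℕ.>-nonZero 0<t}} (divides ∣ q ∣ t≡∣q∣m))
      where
      t≡∣q∣m : t ≡ ∣ q ∣ * m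
      t≡∣q∣m = trans (cong ∣_∣ t≡qm) (ℤP.abs-* q (+ m))

    incongruent : ∀ {z r t} → Residue z r → z ≡ r ℤ.+ + t → 0 < t → t < m → ⊥
    incongruent {r = r} {t} (residue q z≡r+qm) z≡r+t 0<t t<m =
      not-multiple q 0<t t<m (ℤ-cancelˡ r (+ t) (q ℤ.* + m) (trans (sym z≡r+t) z≡r+qm))

    Low : Subset G
    Low x = Σ ℕ λ e → e ≤ 1 × Residue (φ x) (+ e)

    ε-low : Low ε
    ε-low = 0 , z≤n , subst (λ z → Residue z 0ℤ) (sym φ-ε) (residue-refl 0ℤ)

    unit : Carrier
    unit = proj₁ (φ-surj 1ℤ)

    φ-unit : φ unit ≡ 1ℤ
    φ-unit = proj₂ (φ-surj 1ℤ)

    unit-low : Low unit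
    unit-low = 1 , ≤-refl , subst (λ z → Residue z 1ℤ) (sym φ-unit) (residue-refl 1ℤ)

    low-sum : ∀ {k} (v : Vec Carrier k) → All Low v → Σ ℕ λ e → e ≤ k × Residue (φ (vsum G v)) (+ e)
    low-sum [] [] = 0 , z≤n , proj₂ (proj₂ ε-low)
    low-sum (y ∷ v) ((e , e≤1 , y≡e) ∷ v∈Low) with low-sum v v∈Low
    ... | e' , e'≤k , v≡e' = e + e' , +-mono-≤ e≤1 e'≤k ,
      subst (λ z → Residue z (+ (e + e'))) (sym (φ-hom y (vsum G v))) (residue-+ y≡e v≡e')

    weight : List Carrier → ℕ
    weight [] = 0
    weight (l ∷ L) = ∣ φ l ∣ + weight L

    outside : ∀ L x → weight L < ∣ φ x ∣ → ¬ Any (x ≈_) L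
    outside (l ∷ L) x heavy (here x≈l) =
      <⇒≱ heavy (subst (_≤ weight (l ∷ L)) (cong ∣_∣ (sym (φ-cong x≈l))) (m≤m+n _ _))
    outside (l ∷ L) x heavy (there x∈L) = outside L x (≤-<-trans (m≤n+m _ _) heavy) x∈L

    fresh : ∀ L → Σ Carrier λ x → ¬ Any (x ≈_) L × Residue (φ x) -1ℤ
    fresh L = x , outside L x heavy , residue (ℤ.- + K) x≡-1
      where
      K : ℕ
      K = suc (weight L)
      x : Carrier
      x = proj₁ (φ-surj (ℤ.- + suc (K * m)))
      φx : φ x ≡ ℤ.- + suc (K * m)
      φx = proj₂ (φ-surj (ℤ.- + suc (K * m)))
      heavy : weight L < ∣ φ x ∣
      heavy = subst (λ z → weight L < ∣ z ∣) (sym φx) (s≤s (≤-trans (n≤1+n _) (m≤m*n K m)))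
      negate : ∀ K M → ℤ.- (1ℤ ℤ.+ K ℤ.* M) ≡ -1ℤ ℤ.+ (ℤ.- K) ℤ.* M
      negate = solve-∀
      x≡-1 : φ x ≡ -1ℤ ℤ.+ (ℤ.- + K) ℤ.* + m
      x≡-1 = trans φx (trans (cong (λ t → ℤ.- (1ℤ ℤ.+ t)) (ℤP.pos-* K m)) (negate (+ K) (+ m)))

    -- With ε, b ∈ S and Low ⊆ S, every x ≡ i·φ(b) + j (mod m) with i < h and
    -- i + j ≤ h lies in hS: x = i·b + j'·unit + y, where y ∈ Low absorbs the
    -- last of the j ones (if any) and the multiple of m.
    represent-sumset : (S : Subset G) → S ε → (∀ {y} → Low y → S y) → ∀ {b} → S b →
      ∀ {h i j x} → i < h → i + j ≤ h → Residue (φ x) (+ i ℤ.* φ b ℤ.+ + j) → sumset G h S x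
    represent-sumset S ε∈S Low⊆S {b} b∈S {h} {i} {x = x} i<h i+j≤h x≡ with split-ones i<h i+j≤h
    ... | j' , e , e≤1 , refl , i+j'<h =
      sumset-mono ε∈S (subst (_≤ h) (+-comm 1 (i + j')) i+j'<h)
        (sumset-≈ (sumset-∙ W∈hS (sumset-single (Low⊆S y∈Low))) W+y≈x)
      where
      open Sumsets S
      W : Carrier
      W = multiple i b ∙ multiple j' unit
      W∈hS : sumset G (i + j') S W
      W∈hS = sumset-∙ (sumset-multiple i b∈S) (sumset-multiple j' (Low⊆S unit-low))
      φW : φ W ≡ + i ℤ.* φ b ℤ.+ + j'
      φW = trans (φ-hom _ _) (cong₂ ℤ._+_ (φ-multiple i b)
             (trans (φ-multiple j' unit) (trans (cong (+ j' ℤ.*_) φ-unit) (ℤP.*-identityʳ (+ j')))))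
      regroup : ∀ A J E → A ℤ.+ (J ℤ.+ E) ≡ E ℤ.+ (A ℤ.+ J)
      regroup = solve-∀
      y∈Low : Low (x ∙ W ⁻¹)
      y∈Low = e , e≤1 , subst (λ z → Residue z (+ e)) (sym (φ-quotient x W))
        (residue-shift (subst (Residue (φ x)) (trans (regroup (+ i ℤ.* φ b) (+ j') (+ e)) (cong (λ t → + e ℤ.+ t) (sym φW))) x≡))
      W+y≈x : W ∙ (x ∙ W ⁻¹) ≈ x
      W+y≈x = ≈-trans (≈-sym (assoc W x (W ⁻¹))) (xyx⁻¹≈y W x)

    module Witness {h s : ℕ} (2≤s : 2 ≤ s) (s<m : s < m) (reach : Reach m h s) where

      a : Carrier
      a = proj₁ (φ-surj (+ s))

      φa : φ a ≡ + s
      φa = proj₂ (φ-surj (+ s))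

      A : Subset G
      A x = Low x ⊎ x ≈ a

      a∉Low : ¬ Low a
      a∉Low (0 , _ , a≡0) = incongruent a≡0 φa (<-≤-trans (s≤s z≤n) 2≤s) s<m
      a∉Low (1 , _ , a≡1) =
        incongruent a≡1 (trans φa (cong +_ (sym (m+[n∸m]≡n 1≤s)))) (m<n⇒0<n∸m 2≤s) (≤-<-trans (m∸n≤m s 1) s<m)
        where
        1≤s : 1 ≤ s
        1≤s = ≤-trans (s≤s z≤n) 2≤s
      a∉Low (suc (suc _) , s≤s () , _)

      -- hA = G: reduce φ x modulo m and use the covering
      sumset-A : ∀ x → sumset G h A x
      sumset-A x with reach (φ x %ℕ m) (n%ℕd<d (φ x) m)
      ... | representation i j q i<h i+j≤h i*s+j≡r+q*m =
        represent-sumset A (inj₁ ε-low) inj₁ (inj₂ ≈-refl) i<h i+j≤h (residue-trans x≡r (residue-sym i*a+j≡r))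
        where
        x≡r : Residue (φ x) (+ (φ x %ℕ m))
        x≡r = residue (φ x /ℕ m) (a≡a%ℕn+[a/ℕn]*n (φ x) m)
        i*a+j≡r : Residue (+ i ℤ.* φ a ℤ.+ + j) (+ (φ x %ℕ m))
        i*a+j≡r = residue (+ q) (trans (cong (λ t → + i ℤ.* t ℤ.+ + j) φa)
          (trans (cong (ℤ._+ + j) (sym (ℤP.pos-* i s)))
          (trans (cong +_ i*s+j≡r+q*m) (cong (λ t → + (φ x %ℕ m) ℤ.+ t) (ℤP.pos-* q m)))))

      R : Subset G
      R = remove G A a

      low-≈ : ∀ {y y'} → y ≈ y' → Low y → Low y'
      low-≈ y≈y' (e , e≤1 , y≡e) = e , e≤1 , subst (λ z → Residue z (+ e)) (φ-cong y≈y') y≡e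

      Low⊆R : ∀ {y} → Low y → R y
      Low⊆R y∈Low = inj₁ y∈Low , λ y≈a → a∉Low (low-≈ y≈a y∈Low)

      R⊆Low : ∀ {y} → R y → Low y
      R⊆Low (inj₁ y∈Low , _) = y∈Low
      R⊆Low (inj₂ y≈a , y≉a) = ⊥-elim (y≉a y≈a)

      -- every x is a sum of m elements of Low: (φ x mod m) units and a remainder
      sumset-R : ∀ x → sumset G m R x
      sumset-R x = represent-sumset R (Low⊆R ε-low) Low⊆R (Low⊆R unit-low)
        (ℕ.>-nonZero⁻¹ m) (<⇒≤ (n%ℕd<d (φ x) m)) (residue (φ x /ℕ m) (a≡a%ℕn+[a/ℕn]*n (φ x) m))

      -- for k < N ≤ m - 1, kR misses all x with φ x ≡ -1, so kR ≁ G
      order : ∀ N → N < m → OrdAtLeast G R N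
      order N N<m k _ k<N (L , kR∼G) with fresh L
      ... | x , x∉L , x≡-1 with Equivalence.from (kR∼G x x∉L) tt
      ... | v , v∈R , v≈x with low-sum v (All.map R⊆Low v∈R)
      ... | e , e≤k , v≡e = incongruent (residue-trans (residue-sym x≡e) x≡-1) refl (s≤s z≤n)
            (≤-<-trans (≤-trans (s≤s e≤k) k<N) N<m)
        where
        x≡e : Residue (φ x) (+ e)
        x≡e = subst (λ z → Residue z (+ e)) (φ-cong v≈x) v≡e

      witness : ∀ N → N < m → XAtLeast G h N
      witness N N<m =
        A , a , cofinite [] (λ x _ → sumset-A x) , (inj₂ ≈-refl , m , ℕ.>-nonZero⁻¹ m , cofinite [] (λ x _ → sumset-R x)) ,
        order N N<m

theorem1p4 : (G : AbelianGroup 0ℓ 0ℓ) → Infinite G → SurjHomToℤ G →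
    (h : ℕ) → 1 ≤ h → XAtLeast G h ((h * (h + 4)) / 3)
theorem1p4 G _ hom 1 _ = SumsetAlgebra.X-at-one G
theorem1p4 G _ hom 2 _ =
  Construction.Modulo.Witness.witness G hom 5 (s≤s (s≤s z≤n)) (s≤s (s≤s (s≤s (s≤s z≤n)))) reach-5-2-3 4 ≤-refl
theorem1p4 G _ hom (suc (suc (suc n))) _ = subst (λ h → XAtLeast G h N) height≡h
  (Construction.Modulo.Witness.witness G hom (modulus p c) (s≤s (s≤s z≤n)) (step<modulus p c 1≤p) (reach-family p c)
     N (m<n*o⇒m/o<n {n = modulus p c} {o = 3} bound))
  where
  open Parameters (parameters-for n)
  N : ℕ
  N = (3 + n) * (3 + n + 4) / 3
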